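{- For every positive integer $n$, every acyclic subset of $[n]^3$ has size at most $6n^2$.
   Context: $[n]=\{1,\dots,n\}$. For integer triples $a,b$, write $a<_2b$ if $a_i<b_i$ for at least two indices $i\in\{1,2,3\}$. A set $T$ of triples is acyclic if the restriction of the relation $<_2$ to $T$ contains no directed cycle, i.e. there are no $t_1,\dots,t_m\in T$ ($m\ge 1$) with $t_1<_2t_2<_2\cdots<_2t_m<_2t_1$. -}

module Defs where

open import Data.Nat using (ℕ; _≤_; _<_)
open import Data.Product using (_×_; _,_; Σ)
open import Data.Sum using (_⊎_)
open import Data.List using (List; []; _∷_)
open import Data.List.Relation.Unary.All using (All)
open import Data.List.Membership.Propositional using (_∈_)
open import Relation.Nullary using (¬_)

-- integer triples (entries of [n]^3 are positive naturals)
Triple : Set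
Triple = ℕ × ℕ × ℕ

_<₂_ : Triple → Triple → Set
(a₁ , a₂ , a₃) <₂ (b₁ , b₂ , b₃) =
  (a₁ < b₁ × a₂ < b₂) ⊎ (a₁ < b₁ × a₃ < b₃) ⊎ (a₂ < b₂ × a₃ < b₃)

In[n]³ : ℕ → Triple → Set
In[n]³ n (a₁ , a₂ , a₃) = (1 ≤ a₁ × a₁ ≤ n) × (1 ≤ a₂ × a₂ ≤ n) × (1 ≤ a₃ × a₃ ≤ n)

data Chain : Triple → List Triple → Triple → Set where
  done : ∀ {x y} → x <₂ y → Chain x [] y
  step : ∀ {x t ts y} → x <₂ t → Chain t ts y → Chain x (t ∷ ts) y

HasCycle : List Triple → Set
HasCycle T = Σ Triple λ t → Σ (List Triple) λ ts →
  (t ∈ T) × All (_∈ T) ts × Chain t ts t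

Acyclic : List Triple → Set
Acyclic T = ¬ HasCycle T

-- Through t = (x, y, z) run the three lines {(x, y - k, z + k)}, {(x + k, y, z - k)} and
-- {(x - k, y + k, z)}. Points u, v, w of T strictly below t on them (u₂ < y, v₃ < z, w₁ < x)
-- would form a cycle u <₂ v <₂ w <₂ u, so in an acyclic T every t is the lowest point of T
-- on one of its three lines. Hence t ↦ (that direction, that line) is injective on T, and
-- only 3 · n · 2n such lines meet [n]³.
module Submission where

open import Defs
open import Data.Nat using (ℕ; _≤_; _*_; NonZero)
open import Data.List using (List; length)
open import Data.List.Relation.Unary.All using (All)
open import Data.List.Relation.Unary.Unique.Propositional using (Unique)

open import Data.Nat using (suc; _+_; _<_; s≤s; z≤n; _≟_; _<?_)
open import Data.Nat.Properties
  using (<-cmp; +-cancelˡ-≡; +-cancelˡ-<; +-monoˡ-<; +-mono-≤; ≤-trans; m≤m+n; module ≤-Reasoning)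
open import Data.Nat.Tactic.RingSolver using (solve-∀)
open import Data.Fin using (Fin; zero; suc; fromℕ<; combine)
open import Data.Fin.Patterns using (0F; 1F; 2F)
open import Data.Fin.Properties using (injective⇒≤; fromℕ<-injective; combine-injective)
open import Data.Product using (_×_; _,_; proj₁; ∃)
open import Data.Sum using (_⊎_; inj₁; inj₂)
open import Data.List using ([]; _∷_; lookup)
open import Data.List.Relation.Unary.All as All using ([]; _∷_)
open import Data.List.Relation.Unary.AllPairs using (_∷_)
open import Data.List.Relation.Unary.Any using (Any; any?)
open import Data.List.Membership.Propositional using (_∈_; find; lose)
open import Data.List.Membership.Propositional.Properties using (∈-lookup)
open import Data.Empty using (⊥-elim)
open import Relation.Nullary using (¬_; Dec; yes; no)
open import Relation.Nullary.Decidable using (_×-dec_)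
open import Relation.Binary using (tri<; tri≈; tri>)
open import Relation.Binary.PropositionalEquality using (_≡_; refl; sym; cong; subst)

module _ {a} {A : Set a} where

  lookup-injective : ∀ {xs : List A} → Unique xs → ∀ i j → lookup xs i ≡ lookup xs j → i ≡ j
  lookup-injective (_  ∷ _) zero    zero    _  = refl
  lookup-injective (x∉ ∷ _) zero    (suc j) eq = ⊥-elim (All.lookup x∉ (∈-lookup j) eq)
  lookup-injective (x∉ ∷ _) (suc i) zero    eq = ⊥-elim (All.lookup x∉ (∈-lookup i) (sym eq))
  lookup-injective (_  ∷ u) (suc i) (suc j) eq = cong suc (lookup-injective u i j eq)

  length≤-of-injection : ∀ {xs : List A} {m} → Unique xs → (f : ∀ {x} → x ∈ xs → Fin m) →
                         (∀ {x y} (x∈ : x ∈ xs) (y∈ : y ∈ xs) → f x∈ ≡ f y∈ → x ≡ y) →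
                         length xs ≤ m
  length≤-of-injection u f f-inj =
    injective⇒≤ (λ {i} {j} eq → lookup-injective u i j (f-inj (∈-lookup i) (∈-lookup j) eq))

m<n∧m+o≡n+p⇒p<o : ∀ {m n o p} → m < n → m + o ≡ n + p → p < o
m<n∧m+o≡n+p⇒p<o {m} {n} {o} {p} m<n eq =
  +-cancelˡ-< m p o (subst (m + p <_) (sym eq) (+-monoˡ-< p m<n))

fromPositive : ∀ {a n} → 1 ≤ a → a ≤ n → Fin n
fromPositive (s≤s z≤n) a≤n = fromℕ< a≤n

fromPositive-injective : ∀ {a b n} (1≤a : 1 ≤ a) (a≤n : a ≤ n) (1≤b : 1 ≤ b) (b≤n : b ≤ n) →
                         fromPositive 1≤a a≤n ≡ fromPositive 1≤b b≤n → a ≡ b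
fromPositive-injective (s≤s z≤n) a≤n (s≤s z≤n) b≤n eq = cong suc (fromℕ<-injective _ _ a≤n b≤n eq)

rotate : Triple → Triple
rotate (x , y , z) = (y , z , x)

rotate-injective : ∀ {s t} → rotate s ≡ rotate t → s ≡ t
rotate-injective refl = refl

<₂-rotate⁻ : ∀ {s t} → rotate s <₂ rotate t → s <₂ t
<₂-rotate⁻ (inj₁ (y<y' , z<z'))        = inj₂ (inj₂ (y<y' , z<z'))
<₂-rotate⁻ (inj₂ (inj₁ (y<y' , x<x'))) = inj₁ (x<x' , y<y')
<₂-rotate⁻ (inj₂ (inj₂ (z<z' , x<x'))) = inj₂ (inj₁ (x<x' , z<z'))

In[n]³-rotate : ∀ {n t} → In[n]³ n t → In[n]³ n (rotate t)
In[n]³-rotate (x∈ , y∈ , z∈) = (y∈ , z∈ , x∈)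

turn : Fin 3 → Triple → Triple
turn 0F t = t
turn 1F t = rotate t
turn 2F t = rotate (rotate t)

turn-injective : ∀ d {s t} → turn d s ≡ turn d t → s ≡ t
turn-injective 0F eq = eq
turn-injective 1F eq = rotate-injective eq
turn-injective 2F eq = rotate-injective (rotate-injective eq)

In[n]³-turn : ∀ {n t} d → In[n]³ n t → In[n]³ n (turn d t)
In[n]³-turn 0F t∈ = t∈
In[n]³-turn 1F t∈ = In[n]³-rotate t∈
In[n]³-turn 2F t∈ = In[n]³-rotate (In[n]³-rotate t∈)

SameLine : Triple → Triple → Set
SameLine (a , b , c) (x , y , z) = a ≡ x × b + c ≡ y + z

Below : Triple → Triple → Set
Below s@(_ , b , _) t@(_ , y , _) = SameLine s t × b < y

below? : ∀ s t → Dec (Below s t)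
below? (a , b , c) (x , y , z) = ((a ≟ x) ×-dec (b + c ≟ y + z)) ×-dec (b <? y)

SameLine-sym : ∀ {s t} → SameLine s t → SameLine t s
SameLine-sym {a , b , c} {x , y , z} (a≡x , e) = sym a≡x , sym e

SameLine-trichotomy : ∀ {s t} → SameLine s t → s ≡ t ⊎ Below s t ⊎ Below t s
SameLine-trichotomy {a , b , c} {x , y , z} st with <-cmp b y
... | tri< b<y _ _ = inj₂ (inj₁ (st , b<y))
... | tri> _ _ y<b = inj₂ (inj₂ (SameLine-sym {a , b , c} {x , y , z} st , y<b))
SameLine-trichotomy {a , b , c} {.a , .b , z} (refl , e) | tri≈ _ refl _ =
  inj₁ (cong (λ c → a , b , c) (+-cancelˡ-≡ b c z e))

Below-cycle-step : ∀ {t u v} → Below u t → Below (rotate v) (rotate t) → u <₂ v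
Below-cycle-step {x , y , z} {.x , u₂ , u₃} {v₁ , .y , v₃} ((refl , _) , u₂<y) ((refl , e) , v₃<z) =
  inj₁ (m<n∧m+o≡n+p⇒p<o v₃<z e , u₂<y)

lineIndex : ∀ {n t} → In[n]³ n t → Fin (n * (n + n))
lineIndex {t = a , b , c} ((1≤a , a≤n) , (1≤b , b≤n) , (_ , c≤n)) =
  combine (fromPositive 1≤a a≤n) (fromPositive (≤-trans 1≤b (m≤m+n b c)) (+-mono-≤ b≤n c≤n))

lineIndex-injective : ∀ {n s t} (s∈ : In[n]³ n s) (t∈ : In[n]³ n t) →
                      lineIndex s∈ ≡ lineIndex t∈ → SameLine s t
lineIndex-injective {s = a , b , c} {a' , b' , c'}
  ((1≤a , a≤n) , (1≤b , b≤n) , (_ , c≤n)) ((1≤a' , a'≤n) , (1≤b' , b'≤n) , (_ , c'≤n)) eq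
  with combine-injective _ _ _ _ eq
... | eq₁ , eq₂ =
  fromPositive-injective 1≤a a≤n 1≤a' a'≤n eq₁ ,
  fromPositive-injective (≤-trans 1≤b (m≤m+n b c)) (+-mono-≤ b≤n c≤n)
                         (≤-trans 1≤b' (m≤m+n b' c')) (+-mono-≤ b'≤n c'≤n) eq₂

Lower : Fin 3 → Triple → Triple → Set
Lower d s t = Below (turn d s) (turn d t)

lower? : ∀ d s t → Dec (Lower d s t)
lower? d s t = below? (turn d s) (turn d t)

-- The three steps are one step rotated; the last closes up because rotate³ t = t by η.
Lower-cycle : ∀ {t u v w} → Lower 0F u t → Lower 1F v t → Lower 2F w t → Chain u (v ∷ w ∷ []) u
Lower-cycle {t} {u} {v} {w} u⋖t v⋖t w⋖t =
  step (Below-cycle-step {t} {u} {v} u⋖t v⋖t)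
    (step (<₂-rotate⁻ (Below-cycle-step {rotate t} {rotate v} {rotate w} v⋖t w⋖t))
      (done (<₂-rotate⁻ (<₂-rotate⁻
        (Below-cycle-step {rotate (rotate t)} {rotate (rotate w)} {rotate (rotate u)} w⋖t u⋖t)))))

Lowest : List Triple → Fin 3 → Triple → Set
Lowest T d t = ¬ Any (λ s → Lower d s t) T

lowest-direction : ∀ {T} → Acyclic T → ∀ t → ∃ λ d → Lowest T d t
lowest-direction {T} acyclic t
  with any? (λ s → lower? 0F s t) T | any? (λ s → lower? 1F s t) T | any? (λ s → lower? 2F s t) T
... | no ¬u | _     | _     = 0F , ¬u
... | yes _ | no ¬v | _     = 1F , ¬v
... | yes _ | yes _ | no ¬w = 2F , ¬w
... | yes ∃u | yes ∃v | yes ∃w with find ∃u | find ∃v | find ∃w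
...   | u , u∈T , u⋖t | v , v∈T , v⋖t | w , w∈T , w⋖t =
  ⊥-elim (acyclic (u , v ∷ w ∷ [] , u∈T , v∈T ∷ w∈T ∷ [] , Lower-cycle {t} u⋖t v⋖t w⋖t))

lowest-unique : ∀ {T} d {s t} → s ∈ T → t ∈ T → Lowest T d s → Lowest T d t →
                SameLine (turn d s) (turn d t) → s ≡ t
lowest-unique d s∈T t∈T s-lowest t-lowest st with SameLine-trichotomy st
... | inj₁ eq         = turn-injective d eq
... | inj₂ (inj₁ s⋖t) = ⊥-elim (t-lowest (lose s∈T s⋖t))
... | inj₂ (inj₂ t⋖s) = ⊥-elim (s-lowest (lose t∈T t⋖s))

directedLineIndex : ∀ {n t} → Fin 3 → In[n]³ n t → Fin (3 * (n * (n + n)))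
directedLineIndex d t∈ = combine d (lineIndex (In[n]³-turn d t∈))

lowest-directedLineIndex-injective :
  ∀ {n T s t} d d' → s ∈ T → t ∈ T → Lowest T d s → Lowest T d' t →
  (s∈ : In[n]³ n s) (t∈ : In[n]³ n t) → directedLineIndex d s∈ ≡ directedLineIndex d' t∈ → s ≡ t
lowest-directedLineIndex-injective d d' s∈T t∈T s-lowest t-lowest s∈ t∈ eq
  with combine-injective d _ d' _ eq
... | refl , same-line =
  lowest-unique d s∈T t∈T s-lowest t-lowest
    (lineIndex-injective (In[n]³-turn d s∈) (In[n]³-turn d t∈) same-line)

6n²≡3·n·2n : ∀ n → 3 * (n * (n + n)) ≡ 6 * (n * n)
6n²≡3·n·2n = solve-∀

lemma2p2 : (n : ℕ) → .{{_ : NonZero n}} → (T : List Triple) → Unique T →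
    All (In[n]³ n) T → Acyclic T → length T ≤ 6 * (n * n)
lemma2p2 n T unique T⊆[n]³ acyclic = begin
  length T           ≤⟨ length≤-of-injection unique code code-injective ⟩
  3 * (n * (n + n))  ≡⟨ 6n²≡3·n·2n n ⟩
  6 * (n * n)        ∎
  where
  open ≤-Reasoning

  code : ∀ {t} → t ∈ T → Fin (3 * (n * (n + n)))
  code {t} t∈T = directedLineIndex (proj₁ (lowest-direction acyclic t)) (All.lookup T⊆[n]³ t∈T)

  code-injective : ∀ {s t} (s∈T : s ∈ T) (t∈T : t ∈ T) → code s∈T ≡ code t∈T → s ≡ t
  code-injective {s} {t} s∈T t∈T =
    let d , s-lowest = lowest-direction acyclic s
        d' , t-lowest = lowest-direction acyclic t
    in lowest-directedLineIndex-injective d d' s∈T t∈T s-lowest t-lowest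
      (All.lookup T⊆[n]³ s∈T) (All.lookup T⊆[n]³ t∈T)
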